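{- Let $k\ge1$. The edge-coloring of $T_{k,3}$ derived from the sequence $S_{2k,k}=1,2,\dots,2k,1,2,\dots,k$ is nonrepetitive.
   Context: $T_{k,h}$ is the rooted tree in which every non-leaf vertex has exactly $k$ children (ordered left to right) and every leaf is at distance $h$ from the root. For a sequence $S=s_1,s_2,\dots$ of length at least $kh$, the edge-coloring of $T_{k,h}$ derived from $S$ is defined as follows: the edges from the root to its children, from left to right, receive indices $1,\dots,k$; if $v$ is a non-root, non-leaf vertex and the edge from $v$ to its parent has index $i$, then the edges from $v$ to its children, from left to right, receive indices $i+1,\dots,i+k$; an edge with index $i$ receives color $s_i$. A repetition is a finite sequence $x_1,\dots,x_{2r}$ ($r\ge1$) with $x_j=x_{j+r}$ for $1\le j\le r$; an edge-coloring is nonrepetitive if the sequence of colors along no path with at least one edge is a repetition. -}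

module Defs where

open import Data.Nat using (ℕ; zero; suc; _+_; _*_; _∸_; _≤_; _≤ᵇ_)
open import Data.Bool using (if_then_else_)
open import Data.Fin using (Fin; toℕ)
open import Data.List using (List; []; _∷_; _++_; [_]; length; map)
open import Data.Nat.ListAction using (sum)
open import Data.List.Relation.Unary.All using (All)
open import Data.List.Relation.Unary.Unique.Propositional using (Unique)
open import Data.Product using (Σ; _×_)
open import Relation.Binary.PropositionalEquality using (_≡_; _≢_)
open import Relation.Nullary using (¬_)

-- A vertex of T_{k,h} is the word of child positions (0-based, left to right)
-- read from the root; the vertices of T_{k,h} are the words of length ≤ h.
Word : ℕ → Set
Word k = List (Fin k)

-- Index of the edge from the parent of (nonempty) w to w:
-- root edges get 1..k, and the children of an edge with index i get i+1..i+k,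
-- so the index of the edge into c₁…cₘ is Σ (cⱼ + 1).
edgeIndex : {k : ℕ} → Word k → ℕ
edgeIndex w = sum (map (λ c → suc (toℕ c)) w)

data Step {k : ℕ} : Word k → Word k → Set where
  down : (u : Word k) (c : Fin k) → Step u (u ++ [ c ])
  up   : (u : Word k) (c : Fin k) → Step (u ++ [ c ]) u

-- Colour of an edge under the colouring derived from the sequence s
-- (s is 1-indexed: s i is the i-th term s_i).
stepColor : {k : ℕ} → (ℕ → ℕ) → {u v : Word k} → Step u v → ℕ
stepColor s (down u c) = s (edgeIndex (u ++ [ c ]))
stepColor s (up u c)   = s (edgeIndex (u ++ [ c ]))

data Walk {k : ℕ} (s : ℕ → ℕ) : List (Word k) → List ℕ → Set where
  single : (v : Word k) → Walk s (v ∷ []) []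
  cons   : {u v : Word k} {vs : List (Word k)} {cs : List ℕ} →
           (e : Step u v) → Walk s (v ∷ vs) cs →
           Walk s (u ∷ v ∷ vs) (stepColor s e ∷ cs)

IsRepetition : List ℕ → Set
IsRepetition xs = Σ (List ℕ) (λ ys → ys ≢ [] × xs ≡ ys ++ ys)

Nonrepetitive : (k h : ℕ) → (ℕ → ℕ) → Set
Nonrepetitive k h s =
  (vs : List (Word k)) (cs : List ℕ) →
  All (λ v → length v ≤ h) vs → Unique vs → Walk s vs cs →
  cs ≢ [] → ¬ IsRepetition cs

-- S_{2k,k} = 1,2,…,2k,1,2,…,k  (s_i for 1 ≤ i ≤ 3k; value outside irrelevant).
S2kk : ℕ → ℕ → ℕ
S2kk k i = if i ≤ᵇ 2 * k then i else i ∸ 2 * k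

-- S_{2k,k}(x) = S_{2k,k}(y) forces x = y or |x − y| = 2k. A path in T_{k,3} goes up and then
-- down, so it has at most six edges and a repetition on it has length 2, 4 or 6. Two edges
-- below a common vertex whose extra depth is at most two have indices differing by less
-- than 2k, so equal colours there mean equal indices; this contradicts either the strict
-- growth of indices along a branch or the distinctness of siblings. A difference of exactly
-- 2k is only possible on the six-edge path leaf–top–leaf, where both outer pairs of equal
-- colours must wrap around; the two wrap-arounds give opposite inequalities between the
-- indices of the two edges at the top, so the path visits the same vertex twice.
module Submission where

open import Defs
open import Data.Nat using (ℕ; _≥_; suc; _+_; _*_; _∸_; _≤_; _<_; _≤ᵇ_; z≤n; s≤s)
open import Data.Nat.ListAction using (sum)
open import Data.Nat.ListAction.Properties using (sum-++; sum-↭)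
open import Data.Nat.Properties
open import Algebra.Properties.CommutativeSemigroup +-commutativeSemigroup using (xy∙z≈xz∙y)
open import Data.Bool using (true; false; T)
open import Data.Unit using (tt)
open import Data.Fin using (Fin; toℕ)
open import Data.Fin.Properties using (toℕ-injective; toℕ<n)
open import Data.List using (List; []; _∷_; _++_; [_]; length; map; reverse)
open import Data.List.Properties using (map-++; reverse-map; reverse-++; reverse-injective; length-reverse; length-++-≤ʳ)
open import Data.List.Relation.Binary.Permutation.Propositional.Properties using (↭-reverse)
open import Data.List.Relation.Unary.All using (All; []; _∷_)
import Data.List.Relation.Unary.All as All
import Data.List.Relation.Unary.All.Properties as All
open import Data.List.Relation.Unary.AllPairs using (_∷_)
open import Data.List.Relation.Unary.Unique.Propositional using (Unique)
import Data.List.Relation.Unary.Unique.Propositional.Properties as Unique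
open import Data.Product using (_×_; _,_)
open import Data.Sum using (_⊎_; inj₁; inj₂)
open import Data.Empty using (⊥-elim)
open import Relation.Binary.PropositionalEquality using (_≡_; refl; sym; trans; cong; subst; subst₂; _≢_)
open import Relation.Nullary using (¬_)

module _ {k : ℕ} where

  weight : Fin k → ℕ
  weight c = suc (toℕ c)

  edgeIndex-++ : (v u : Word k) → edgeIndex (v ++ u) ≡ edgeIndex v + edgeIndex u
  edgeIndex-++ v u = trans (cong sum (map-++ weight v u)) (sum-++ (map weight v) (map weight u))

  edgeIndex-reverse : (u : Word k) → edgeIndex (reverse u) ≡ edgeIndex u
  edgeIndex-reverse u = trans (cong sum (reverse-map weight u)) (sum-↭ (↭-reverse (map weight u)))

  edgeIndex-≤ : (v : Word k) → edgeIndex v ≤ length v * k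
  edgeIndex-≤ []      = z≤n
  edgeIndex-≤ (c ∷ v) = +-mono-≤ (toℕ<n c) (edgeIndex-≤ v)

  edgeIndex-<-++ : (c : Fin k) (v u : Word k) → edgeIndex u < edgeIndex ((c ∷ v) ++ u)
  edgeIndex-<-++ c v u = begin-strict
    edgeIndex u                   <⟨ m<n+m (edgeIndex u) (s≤s z≤n) ⟩
    edgeIndex (c ∷ v) + edgeIndex u ≡⟨ sym (edgeIndex-++ (c ∷ v) u) ⟩
    edgeIndex ((c ∷ v) ++ u)      ∎
    where open ≤-Reasoning

  edgeIndex-[-]-injective : {c d : Fin k} → edgeIndex [ c ] ≡ edgeIndex [ d ] → c ≡ d
  edgeIndex-[-]-injective {c} {d} eq =
    toℕ-injective (suc-injective (+-cancelʳ-≡ 0 (weight c) (weight d) eq))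

-- Vertices are stored as reversed words, so that the edge into c ∷ u has index
-- (toℕ c + 1) + edgeIndex u and consecutive steps unify by pattern matching.
data RevWalk {k : ℕ} (s : ℕ → ℕ) : List (Word k) → List ℕ → Set where
  single : (v : Word k) → RevWalk s (v ∷ []) []
  down   : {u : Word k} {vs : List (Word k)} {cs : List ℕ} (c : Fin k) →
           RevWalk s ((c ∷ u) ∷ vs) cs → RevWalk s (u ∷ (c ∷ u) ∷ vs) (s (edgeIndex (c ∷ u)) ∷ cs)
  up     : {u : Word k} {vs : List (Word k)} {cs : List ℕ} (c : Fin k) →
           RevWalk s (u ∷ vs) cs → RevWalk s ((c ∷ u) ∷ u ∷ vs) (s (edgeIndex (c ∷ u)) ∷ cs)

toRevWalk : {k : ℕ} {s : ℕ → ℕ} {vs : List (Word k)} {cs : List ℕ} →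
            Walk s vs cs → RevWalk s (map reverse vs) cs
toRevWalk (single v) = single (reverse v)
toRevWalk (cons (down u c) w) with toRevWalk w
... | w′ rewrite sym (edgeIndex-reverse (u ++ [ c ])) | reverse-++ u [ c ] = down c w′
toRevWalk (cons (up u c) w) with toRevWalk w
... | w′ rewrite sym (edgeIndex-reverse (u ++ [ c ])) | reverse-++ u [ c ] = up c w′

Unique-head≢third : {A : Set} {x y z : A} {xs : List A} → Unique (x ∷ y ∷ z ∷ xs) → x ≢ z
Unique-head≢third ((_ ∷ x≢z ∷ _) ∷ _) = x≢z

WithinDepth : {k : ℕ} → ℕ → List (Word k) → Set
WithinDepth h = All (λ v → length v ≤ h)

module _ {k : ℕ} {s : ℕ → ℕ} (h : ℕ) where

  -- Having come down from u, a path can never step up again: its first up-step would return to u.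
  descent-length : {u : Word k} {c : Fin k} {vs : List (Word k)} {cs : List ℕ} →
                   RevWalk s ((c ∷ u) ∷ vs) cs → Unique (u ∷ (c ∷ u) ∷ vs) →
                   WithinDepth h ((c ∷ u) ∷ vs) → length cs + length (c ∷ u) ≤ h
  descent-length (single _) _ (d ∷ []) = d
  descent-length {u} {c} (down {cs = cs} d w) (_ ∷ U) (_ ∷ D) =
    subst (_≤ h) (+-suc (length cs) (length (c ∷ u))) (descent-length w U D)
  descent-length (up _ _) U _ = ⊥-elim (Unique-head≢third U refl)

  path-length : {v : Word k} {vs : List (Word k)} {cs : List ℕ} →
                RevWalk s (v ∷ vs) cs → Unique (v ∷ vs) → WithinDepth h (v ∷ vs) →
                length cs ≤ length v + h
  path-length (single _) _ _ = z≤n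
  path-length {v} (down {cs = cs} c w) U (_ ∷ D) = begin
    suc (length cs)            ≤⟨ m≤m+n (suc (length cs)) (length v) ⟩
    suc (length cs) + length v ≡⟨ sym (+-suc (length cs) (length v)) ⟩
    length cs + length (c ∷ v) ≤⟨ descent-length w U D ⟩
    h                          ≤⟨ m≤n+m h (length v) ⟩
    length v + h               ∎
    where open ≤-Reasoning
  path-length (up _ w) (_ ∷ U) (_ ∷ D) = s≤s (path-length w U D)

module _ (k : ℕ) where

  private
    S : ℕ → ℕ
    S = S2kk k

  S2kk-cases : ∀ x → (x ≤ 2 * k × S x ≡ x) ⊎ (2 * k < x × S x ≡ x ∸ 2 * k)
  S2kk-cases x with x ≤ᵇ 2 * k in eq
  ... | true  = inj₁ (≤ᵇ⇒≤ x (2 * k) (subst T (sym eq) tt) , refl)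
  ... | false = inj₂ (≰⇒> (λ x≤2k → subst T eq (≤⇒≤ᵇ x≤2k)) , refl)

  Collision : ℕ → ℕ → Set
  Collision x y = x ≡ y ⊎ x ≡ y + 2 * k ⊎ y ≡ x + 2 * k

  S2kk-collision : ∀ x y → S x ≡ S y → Collision x y
  S2kk-collision x y eq with S2kk-cases x | S2kk-cases y
  ... | inj₁ (_ , Sx) | inj₁ (_ , Sy) = inj₁ (trans (sym Sx) (trans eq Sy))
  ... | inj₂ (x> , Sx) | inj₂ (y> , Sy) =
    inj₁ (∸-cancelʳ-≡ (<⇒≤ x>) (<⇒≤ y>) (trans (sym Sx) (trans eq Sy)))
  ... | inj₂ (x> , Sx) | inj₁ (_ , Sy) =
    inj₂ (inj₁ (trans (sym (m∸n+n≡m (<⇒≤ x>))) (cong (_+ 2 * k) (trans (sym Sx) (trans eq Sy)))))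
  ... | inj₁ (_ , Sx) | inj₂ (y> , Sy) =
    inj₂ (inj₂ (trans (sym (m∸n+n≡m (<⇒≤ y>))) (cong (_+ 2 * k) (trans (sym Sy) (trans (sym eq) Sx)))))

  Collision-cancelʳ : ∀ a p q → Collision (p + a) (q + a) → Collision p q
  Collision-cancelʳ a p q (inj₁ eq)        = inj₁ (+-cancelʳ-≡ a p q eq)
  Collision-cancelʳ a p q (inj₂ (inj₁ eq)) =
    inj₂ (inj₁ (+-cancelʳ-≡ a p (q + 2 * k) (trans eq (xy∙z≈xz∙y q a (2 * k)))))
  Collision-cancelʳ a p q (inj₂ (inj₂ eq)) =
    inj₂ (inj₂ (+-cancelʳ-≡ a q (p + 2 * k) (trans eq (xy∙z≈xz∙y p a (2 * k)))))

  S2kk-suffix-collision : (v w u : Word k) →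
                          S (edgeIndex (v ++ u)) ≡ S (edgeIndex (w ++ u)) →
                          Collision (edgeIndex v) (edgeIndex w)
  S2kk-suffix-collision v w u eq =
    Collision-cancelʳ (edgeIndex u) (edgeIndex v) (edgeIndex w)
      (S2kk-collision _ _ (subst₂ (λ x y → S x ≡ S y) (edgeIndex-++ v u) (edgeIndex-++ w u) eq))

  Collision-near : ∀ {p q} → p < q + 2 * k → q < p + 2 * k → Collision p q → p ≡ q
  Collision-near _   _   (inj₁ eq)        = eq
  Collision-near p<q _   (inj₂ (inj₁ eq)) = ⊥-elim (<⇒≢ p<q eq)
  Collision-near _   q<p (inj₂ (inj₂ eq)) = ⊥-elim (<⇒≢ q<p eq)

  Collision-far : ∀ {p q} → q < p → q ≤ 2 * k → Collision p q → p ≡ q + 2 * k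
  Collision-far q<p _    (inj₁ eq)        = ⊥-elim (<⇒≢ q<p (sym eq))
  Collision-far _   _    (inj₂ (inj₁ eq)) = eq
  Collision-far q<p q≤2k (inj₂ (inj₂ eq)) =
    ⊥-elim (<⇒≢ (≤-<-trans q≤2k (m<n+m (2 * k) (≤-trans (s≤s z≤n) q<p))) eq)

  data Short : Word k → Set where
    short₁ : (c : Fin k) → Short [ c ]
    short₂ : (c d : Fin k) → Short (c ∷ [ d ])

  Short-≤ : {v : Word k} → Short v → edgeIndex v ≤ 2 * k
  Short-≤ (short₁ c)   = ≤-trans (edgeIndex-≤ [ c ]) (+-monoʳ-≤ k z≤n)
  Short-≤ (short₂ c d) = edgeIndex-≤ (c ∷ [ d ])

  Short-window : {v w : Word k} → Short v → Short w → edgeIndex v < edgeIndex w + 2 * k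
  Short-window sv sw = ≤-<-trans (Short-≤ sv) (m<n+m (2 * k) (positive sw))
    where
    positive : {w : Word k} → Short w → 0 < edgeIndex w
    positive (short₁ _)   = s≤s z≤n
    positive (short₂ _ _) = s≤s z≤n

  S2kk-cancel : {v w : Word k} → Short v → Short w → (u : Word k) →
                S (edgeIndex (v ++ u)) ≡ S (edgeIndex (w ++ u)) → edgeIndex v ≡ edgeIndex w
  S2kk-cancel {v} {w} sv sw u eq =
    Collision-near (Short-window sv sw) (Short-window sw sv) (S2kk-suffix-collision v w u eq)

  S2kk-descendant-≢ : (c : Fin k) (v u : Word k) → edgeIndex (c ∷ v) < 2 * k →
                      S (edgeIndex u) ≢ S (edgeIndex ((c ∷ v) ++ u))
  S2kk-descendant-≢ c v u small eq
    with Collision-near (s≤s z≤n) small (S2kk-suffix-collision [] (c ∷ v) u eq)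
  ... | ()

  edgeIndex-pair-< : (a b d c : Fin k) → edgeIndex (b ∷ [ d ]) ≡ edgeIndex [ c ] →
                     edgeIndex (a ∷ [ b ]) < 2 * k
  edgeIndex-pair-< a b d c eq = begin-strict
    edgeIndex (a ∷ [ b ])        <⟨ +-monoʳ-< (weight a) (+-monoʳ-< (weight b) (s≤s z≤n)) ⟩
    edgeIndex (a ∷ b ∷ [ d ])    ≡⟨ cong (weight a +_) eq ⟩
    weight a + edgeIndex [ c ]   ≤⟨ +-mono-≤ (toℕ<n a) (edgeIndex-≤ [ c ]) ⟩
    2 * k                        ∎
    where open ≤-Reasoning

  -- The index of a b c exceeds that of d, so equal colours force a wrap-around by exactly 2k.
  S2kk-wrap-≤ : (a b c d e : Fin k) (u : Word k) → edgeIndex (b ∷ [ c ]) ≡ edgeIndex (e ∷ [ d ]) →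
                S (edgeIndex (a ∷ b ∷ c ∷ u)) ≡ S (edgeIndex (d ∷ u)) → edgeIndex [ d ] ≤ edgeIndex [ c ]
  S2kk-wrap-≤ a b c d e u eq same = +-cancelʳ-≤ (2 * k) _ _ (begin
    edgeIndex [ d ] + 2 * k                 ≡⟨ sym wrap ⟩
    edgeIndex (a ∷ b ∷ [ c ])               ≡⟨ edgeIndex-++ (a ∷ [ b ]) [ c ] ⟩
    edgeIndex (a ∷ [ b ]) + edgeIndex [ c ] ≤⟨ +-monoˡ-≤ (edgeIndex [ c ]) (Short-≤ (short₂ a b)) ⟩
    2 * k + edgeIndex [ c ]                 ≡⟨ +-comm (2 * k) (edgeIndex [ c ]) ⟩
    edgeIndex [ c ] + 2 * k                 ∎)
    where
    open ≤-Reasoning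
    d<abc : edgeIndex [ d ] < edgeIndex (a ∷ b ∷ [ c ])
    d<abc = begin-strict
      edgeIndex [ d ]           <⟨ edgeIndex-<-++ e [] [ d ] ⟩
      edgeIndex (e ∷ [ d ])     ≡⟨ sym eq ⟩
      edgeIndex (b ∷ [ c ])     <⟨ edgeIndex-<-++ a [] (b ∷ [ c ]) ⟩
      edgeIndex (a ∷ b ∷ [ c ]) ∎
    wrap : edgeIndex (a ∷ b ∷ [ c ]) ≡ edgeIndex [ d ] + 2 * k
    wrap = Collision-far d<abc (Short-≤ (short₁ d)) (S2kk-suffix-collision (a ∷ b ∷ [ c ]) [ d ] u same)

  private
    4+n≰3 : {n : ℕ} → ¬ 4 + n ≤ 3
    4+n≰3 (s≤s (s≤s (s≤s ())))

  consecutive-colours-differ : {vs : List (Word k)} {x₁ x₂ : ℕ} →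
                               RevWalk S vs (x₁ ∷ x₂ ∷ []) → Unique vs → x₁ ≢ x₂
  consecutive-colours-differ (down {u} c (down d _)) _ eq =
    <⇒≢ (edgeIndex-<-++ d [] [ c ]) (S2kk-cancel (short₁ c) (short₂ d c) u eq)
  consecutive-colours-differ (down _ (up _ _)) U _ = Unique-head≢third U refl
  consecutive-colours-differ (up c (up {u} d _)) _ eq =
    <⇒≢ (edgeIndex-<-++ c [] [ d ]) (sym (S2kk-cancel (short₂ c d) (short₁ d) u eq))
  consecutive-colours-differ (up {u} c (down d _)) U eq =
    Unique-head≢third U (cong (_∷ u) (edgeIndex-[-]-injective (S2kk-cancel (short₁ c) (short₁ d) u eq)))

  no-repetition₄ : {vs : List (Word k)} {x₁ x₂ x₃ x₄ : ℕ} →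
                   RevWalk S vs (x₁ ∷ x₂ ∷ x₃ ∷ x₄ ∷ []) → Unique vs → WithinDepth 3 vs →
                   x₁ ≡ x₃ → x₂ ≢ x₄
  no-repetition₄ (down _ w) U (_ ∷ D) _ _ = 4+n≰3 (descent-length 3 w U D)
  no-repetition₄ (up _ (down _ (up _ _))) (_ ∷ U) _ _ _ = Unique-head≢third U refl
  no-repetition₄ (up _ (down _ (down _ (up _ _)))) (_ ∷ _ ∷ U) _ _ _ = Unique-head≢third U refl
  no-repetition₄ (up {u} c (down d₁ (down d₂ (down d₃ _)))) _ _ e₁₃ e₂₄ =
    S2kk-descendant-≢ d₃ [ d₂ ] (d₁ ∷ u) (edgeIndex-pair-< d₃ d₂ d₁ c (sym h₁₃)) e₂₄
    where
    h₁₃ : edgeIndex [ c ] ≡ edgeIndex (d₂ ∷ [ d₁ ])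
    h₁₃ = S2kk-cancel (short₁ c) (short₂ d₂ d₁) u e₁₃
  no-repetition₄ (up _ (up _ (down _ (up _ _)))) (_ ∷ _ ∷ U) _ _ _ = Unique-head≢third U refl
  no-repetition₄ (up c₂ (up {u} c₁ (down d₁ (down d₂ _)))) _ _ e₁₃ e₂₄ = <-irrefl refl (begin-strict
    edgeIndex [ c₁ ]         <⟨ edgeIndex-<-++ c₂ [] [ c₁ ] ⟩
    edgeIndex (c₂ ∷ [ c₁ ])  ≡⟨ S2kk-cancel (short₂ c₂ c₁) (short₁ d₁) u e₁₃ ⟩
    edgeIndex [ d₁ ]         <⟨ edgeIndex-<-++ d₂ [] [ d₁ ] ⟩
    edgeIndex (d₂ ∷ [ d₁ ])  ≡⟨ sym (S2kk-cancel (short₁ c₁) (short₂ d₂ d₁) u e₂₄) ⟩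
    edgeIndex [ c₁ ]         ∎)
    where open ≤-Reasoning
  no-repetition₄ (up c₃ (up c₂ (up {u} c₁ (down d _)))) _ _ e₁₃ e₂₄ =
    S2kk-descendant-≢ c₃ [ c₂ ] (c₁ ∷ u) (edgeIndex-pair-< c₃ c₂ c₁ d h₂₄) (sym e₁₃)
    where
    h₂₄ : edgeIndex (c₂ ∷ [ c₁ ]) ≡ edgeIndex [ d ]
    h₂₄ = S2kk-cancel (short₂ c₂ c₁) (short₁ d) u e₂₄
  no-repetition₄ (up _ (up _ (up _ (up _ _)))) _ (d ∷ _) _ _ = 4+n≰3 d

  no-repetition₆ : {vs : List (Word k)} {x₁ x₂ x₃ x₄ x₅ x₆ : ℕ} →
                   RevWalk S vs (x₁ ∷ x₂ ∷ x₃ ∷ x₄ ∷ x₅ ∷ x₆ ∷ []) → Unique vs → WithinDepth 3 vs →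
                   x₁ ≡ x₄ → x₂ ≡ x₅ → x₃ ≢ x₆
  no-repetition₆ (down _ w) U (_ ∷ D) _ _ _ = 4+n≰3 (descent-length 3 w U D)
  no-repetition₆ (up _ (down _ w)) (_ ∷ U) (_ ∷ _ ∷ D) _ _ _ = 4+n≰3 (descent-length 3 w U D)
  no-repetition₆ (up _ (up _ (down _ w))) (_ ∷ _ ∷ U) (_ ∷ _ ∷ _ ∷ D) _ _ _ =
    4+n≰3 (descent-length 3 w U D)
  no-repetition₆ (up _ (up _ (up _ (down _ (up _ _))))) (_ ∷ _ ∷ _ ∷ U) _ _ _ _ =
    Unique-head≢third U refl
  no-repetition₆ (up _ (up _ (up _ (down _ (down _ (up _ _)))))) (_ ∷ _ ∷ _ ∷ _ ∷ U) _ _ _ _ =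
    Unique-head≢third U refl
  no-repetition₆ (up c₃ (up c₂ (up {u} c₁ (down d₁ (down d₂ (down d₃ _)))))) (_ ∷ _ ∷ U) _ e₁₄ e₂₅ e₃₆ =
    Unique-head≢third U (cong (_∷ u) (edgeIndex-[-]-injective (≤-antisym c₁≤d₁ d₁≤c₁)))
    where
    h₂₅ : edgeIndex (c₂ ∷ [ c₁ ]) ≡ edgeIndex (d₂ ∷ [ d₁ ])
    h₂₅ = S2kk-cancel (short₂ c₂ c₁) (short₂ d₂ d₁) u e₂₅
    d₁≤c₁ : edgeIndex [ d₁ ] ≤ edgeIndex [ c₁ ]
    d₁≤c₁ = S2kk-wrap-≤ c₃ c₂ c₁ d₁ d₂ u h₂₅ e₁₄
    c₁≤d₁ : edgeIndex [ c₁ ] ≤ edgeIndex [ d₁ ]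
    c₁≤d₁ = S2kk-wrap-≤ d₃ d₂ d₁ c₁ c₂ u (sym h₂₅) (sym e₃₆)
  no-repetition₆ (up _ (up _ (up _ (up _ _)))) _ (d ∷ _) _ _ _ = 4+n≰3 d

  no-repetition : {vs : List (Word k)} {cs : List ℕ} →
                  RevWalk S vs cs → Unique vs → WithinDepth 3 vs → ¬ IsRepetition cs
  no-repetition _ _ _ ([] , ys≢[] , _) = ys≢[] refl
  no-repetition w U _ (_ ∷ [] , _ , refl) = consecutive-colours-differ w U refl
  no-repetition w U D (_ ∷ _ ∷ [] , _ , refl) = no-repetition₄ w U D refl refl
  no-repetition w U D (_ ∷ _ ∷ _ ∷ [] , _ , refl) = no-repetition₆ w U D refl refl refl
  no-repetition w U D@(d ∷ _) (ys@(_ ∷ _ ∷ _ ∷ _ ∷ zs) , _ , refl) = <⇒≱ too-long short-path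
    where
    too-long : 6 < length (ys ++ ys)
    too-long = +-monoʳ-≤ 4 (≤-trans (s≤s (s≤s (s≤s z≤n))) (length-++-≤ʳ ys {zs}))
    short-path : length (ys ++ ys) ≤ 6
    short-path = ≤-trans (path-length 3 w U D) (+-monoˡ-≤ 3 d)

proposition11 : (k : ℕ) → k ≥ 1 → Nonrepetitive k 3 (S2kk k)
proposition11 k _ vs cs D U w _ = no-repetition k (toRevWalk w)
  (Unique.map⁺ reverse-injective U)
  (All.map⁺ (All.map (λ {v} d → subst (_≤ 3) (sym (length-reverse v)) d) D))
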